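{- Let $m\geq 3$ be an integer, let $\mathbb{F}_{2^m}$ be the finite field with $2^m$ elements and $\mathbb{F}_{2^m}^*=\mathbb{F}_{2^m}\setminus\{0\}$. Let $k$ be an integer with $3\leq k\leq 2^m-4$. For distinct $i,j\in\mathbb{F}_{2^m}^*$ let $W_k^{i,j}=\{B\in W_k : i,j\in B\}$. Then for any three distinct elements $i,j,\ell\in\mathbb{F}_{2^m}^*$ we have $|W_k^{i,j}|=|W_k^{i,\ell}|$.
   Context: For $3\leq k\leq 2^m-4$, $W_k=\{B\subseteq \mathbb{F}_{2^m}^* : |B|=k \text{ and } \sum_{x\in B}x=0\}$ is the collection of $k$-subsets of nonzero field elements whose elements sum to zero in $\mathbb{F}_{2^m}$. -}

module Defs where

open import Data.Bool using (Bool; true; false; _xor_)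
import Data.Bool as Bool
open import Data.Nat using (ℕ; zero; suc)
import Data.Nat as ℕ
open import Data.Vec using (Vec; []; _∷_; zipWith; replicate)
import Data.Vec.Properties as VecP
open import Data.List using (List; []; _∷_; _++_; map; filter; foldr; length; [_])
open import Data.List.Membership.DecPropositional using ()
import Data.List.Membership.DecPropositional as DecMem
open import Data.Product using (_×_)
open import Relation.Nullary using (¬_; Dec; ¬?)
open import Relation.Nullary.Decidable using (_×-dec_)
open import Relation.Binary.PropositionalEquality using (_≡_)
open import Relation.Binary.Definitions using (DecidableEquality)

-- The field F_{2^m}, represented through its additive group: coordinate
-- vectors over F_2 = Bool w.r.t. an F_2-basis of F_{2^m}; field addition
-- is coordinatewise xor.  Only addition occurs in the statement.
F : ℕ → Set
F m = Vec Bool m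

0F : ∀ {m} → F m
0F = replicate _ false

_⊕_ : ∀ {m} → F m → F m → F m
_⊕_ = zipWith _xor_

_≟F_ : ∀ {m} → DecidableEquality (F m)
_≟F_ = VecP.≡-dec Bool._≟_

allF : (m : ℕ) → List (F m)
allF zero = [ [] ]
allF (suc m) = map (false ∷_) (allF m) ++ map (true ∷_) (allF m)

nonzeroF : (m : ℕ) → List (F m)
nonzeroF m = filter (λ x → ¬? (x ≟F 0F)) (allF m)

-- All sublists of a list; for a duplicate-free list these are exactly its
-- subsets (each listed once).
sublists : ∀ {a} {A : Set a} → List A → List (List A)
sublists [] = [ [] ]
sublists (x ∷ xs) = map (x ∷_) (sublists xs) ++ sublists xs

sumF : ∀ {m} → List (F m) → F m
sumF = foldr _⊕_ 0F

_∈F?_ : ∀ {m} (x : F m) (B : List (F m)) → Dec (DecMem._∈_ _≟F_ x B)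
_∈F?_ = DecMem._∈?_ _≟F_

W : (m k : ℕ) → List (List (F m))
W m k = filter (λ B → (length B ℕ.≟ k) ×-dec (sumF B ≟F 0F)) (sublists (nonzeroF m))

Wij : (m k : ℕ) → F m → F m → List (List (F m))
Wij m k i j = filter (λ B → (i ∈F? B) ×-dec (j ∈F? B)) (W m k)

cardWij : (m k : ℕ) → F m → F m → ℕ
cardWij m k i j = length (Wij m k i j)

{-# OPTIONS --safe #-}
module Submission where

-- Over F₂ the vector j is not in the span of i and j ⊕ l, so some linear form f has
-- f i = f (j ⊕ l) = 0 and f j = 1.  The transvection σ x = x ⊕ f(x)·(j ⊕ l) is then a linear
-- involution of F_{2^m} that fixes i and exchanges j and l.  It permutes F*, and applying it
-- elementwise preserves sizes and zero sums, so it maps W_k^{i,j} bijectively onto W_k^{i,l}.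
-- As subsets are sublists of an enumeration of F*, the bijection becomes a count: the number of
-- sublists satisfying a permutation-invariant predicate depends on the list only up to permutation.

open import Defs
open import Data.Nat using (ℕ; _≤_; _^_; _∸_)
open import Relation.Binary.PropositionalEquality using (_≡_; _≢_)

open import Algebra.Bundles using (AbelianGroup)
open import Algebra.Structures using (IsAbelianGroup)
import Algebra.Properties.AbelianGroup as AbelianGroupProperties
import Algebra.Properties.CommutativeSemigroup as CommutativeSemigroupProperties
open import Data.Bool using (Bool; true; false; _xor_)
open import Data.Bool.Properties using (xor-assoc; xor-comm; xor-identityˡ; xor-identityʳ; xor-same)
open import Data.Empty using (⊥-elim)
open import Data.Fin using (Fin)
import Data.Fin as Fin
open import Data.List using (List; []; _∷_; _++_; map; filter; length)
open import Data.List.Properties using (filter-++; filter-≐; length-++; length-map; map-++; map-∘; map-cong; map-id)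
open import Data.List.Membership.Propositional using (_∈_)
open import Data.List.Membership.Propositional.Properties using (∈-map⁺; ∈-map⁻; ∈-++⁺ˡ; ∈-++⁺ʳ; ∈-filter⁺; ∈-filter⁻)
open import Data.List.Membership.Propositional.Properties.WithK using (unique∧set⇒bag)
open import Data.List.Relation.Binary.BagAndSetEquality using (∼bag⇒↭)
open import Data.List.Relation.Binary.Permutation.Propositional using (_↭_; refl; prep; swap; trans; ↭⇒↭ₛ)
open import Data.List.Relation.Binary.Permutation.Propositional.Properties using (↭-length; ∈-resp-↭)
open import Data.List.Relation.Binary.Permutation.Setoid.Properties using (foldr-commMonoid)
import Data.List.Relation.Unary.All as All
open import Data.List.Relation.Unary.AllPairs using ([]; _∷_)
open import Data.List.Relation.Unary.Any using (here)
open import Data.List.Relation.Unary.Unique.Propositional using (Unique)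
import Data.List.Relation.Unary.Unique.Propositional.Properties as Unique
open import Data.Nat using (zero; suc; _+_) renaming (_≟_ to _ℕ-≟_)
open import Data.Nat.Properties using (+-commutativeSemigroup)
open CommutativeSemigroupProperties +-commutativeSemigroup using () renaming (interchange to +-interchange)
open import Data.Product using (∃; ∃₂; _×_; _,_; proj₂)
open import Data.Sum using (_⊎_; inj₁; inj₂)
open import Data.Vec using ([]; _∷_; lookup)
open import Data.Vec.Properties using (zipWith-assoc; zipWith-comm; zipWith-identityˡ; zipWith-identityʳ; lookup-zipWith; lookup-replicate; ∷-injectiveʳ)
open import Function using (id; _∘_; mk⇔)
open import Level using (0ℓ)
open import Relation.Binary.Definitions using (_Respects_)
open import Relation.Binary.PropositionalEquality using (refl; sym; cong; cong₂; subst; setoid; module ≡-Reasoning)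
  renaming (trans to ≡-trans)
open import Relation.Binary.PropositionalEquality.Algebra using (isMagma)
open import Relation.Nullary using (¬_; ¬?; does)
open import Relation.Nullary.Decidable using (_×-dec_)
open import Relation.Unary using (Pred; Decidable; _≐_)
open import Relation.Unary.Properties using (_∩?_)

open ≡-Reasoning

⊕-self : ∀ {m} (x : F m) → x ⊕ x ≡ 0F
⊕-self []      = refl
⊕-self (b ∷ x) = cong₂ _∷_ (xor-same b) (⊕-self x)

⊕-isAbelianGroup : ∀ {m} → IsAbelianGroup _≡_ (_⊕_ {m}) 0F id
⊕-isAbelianGroup = record
  { isGroup = record
    { isMonoid = record
      { isSemigroup = record { isMagma = isMagma _⊕_ ; assoc = zipWith-assoc xor-assoc }
      ; identity    = zipWith-identityˡ xor-identityˡ , zipWith-identityʳ xor-identityʳ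
      }
    ; inverse = ⊕-self , ⊕-self
    ; ⁻¹-cong = cong id
    }
  ; comm = zipWith-comm xor-comm
  }

⊕-abelianGroup : ℕ → AbelianGroup 0ℓ 0ℓ
⊕-abelianGroup m = record { isAbelianGroup = ⊕-isAbelianGroup {m} }

module _ {m : ℕ} where
  open AbelianGroup (⊕-abelianGroup m) public
    using (isCommutativeMonoid)
    renaming (identityˡ to ⊕-identityˡ; identityʳ to ⊕-identityʳ)
  open AbelianGroupProperties (⊕-abelianGroup m) public
    using ()
    renaming (inverseˡ-unique to ⊕≡0F⇒≡; \\-leftDividesˡ to ⊕-cancelˡ; //-rightDividesʳ to ⊕-cancelʳ)
  open CommutativeSemigroupProperties (AbelianGroup.commutativeSemigroup (⊕-abelianGroup m)) public
    using ()
    renaming (interchange to ⊕-interchange; x∙yz≈y∙xz to ⊕-leftComm)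

x≡x⊕y⇒y≡0F : ∀ {m} {x y : F m} → x ≡ x ⊕ y → y ≡ 0F
x≡x⊕y⇒y≡0F {x = x} {y} x≡x⊕y = begin
  y            ≡⟨ ⊕-cancelˡ x y ⟨
  x ⊕ (x ⊕ y)  ≡⟨ cong (x ⊕_) x≡x⊕y ⟨
  x ⊕ x        ≡⟨ ⊕-self x ⟩
  0F           ∎

sumF-↭ : ∀ {m} {B B′ : List (F m)} → B ↭ B′ → sumF B ≡ sumF B′
sumF-↭ = foldr-commMonoid (setoid _) isCommutativeMonoid ∘ ↭⇒↭ₛ

infixr 25 _·_

_·_ : ∀ {m} → Bool → F m → F m
true  · v = v
false · v = 0F

·-distribʳ-xor : ∀ {m} α β (v : F m) → (α xor β) · v ≡ α · v ⊕ β · v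
·-distribʳ-xor false β    v = sym (⊕-identityˡ (β · v))
·-distribʳ-xor true false v = sym (⊕-identityʳ v)
·-distribʳ-xor true true  v = sym (⊕-self v)

record IsLinear {m n} (E : F m → F n) : Set where
  constructor isLinear
  field ⊕-homo : ∀ x y → E (x ⊕ y) ≡ E x ⊕ E y

record IsLinearForm {m} (f : F m → Bool) : Set where
  constructor isLinearForm
  field ⊕-homo : ∀ x y → f (x ⊕ y) ≡ f x xor f y

id-linear : ∀ {m} → IsLinear {m} id
id-linear = isLinear λ _ _ → refl

module _ {m n} {E : F m → F n} (E-linear : IsLinear E) where
  open IsLinear E-linear

  linear-0F : E 0F ≡ 0F
  linear-0F = begin
    E 0F            ≡⟨ cong E (⊕-self 0F) ⟨
    E (0F ⊕ 0F)     ≡⟨ ⊕-homo 0F 0F ⟩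
    E 0F ⊕ E 0F     ≡⟨ ⊕-self (E 0F) ⟩
    0F              ∎

  linear-· : ∀ α v → E (α · v) ≡ α · E v
  linear-· true  v = refl
  linear-· false v = linear-0F

  linear-sumF : ∀ B → sumF (map E B) ≡ E (sumF B)
  linear-sumF []      = sym linear-0F
  linear-sumF (x ∷ B) = ≡-trans (cong (E x ⊕_) (linear-sumF B)) (sym (⊕-homo x (sumF B)))

  linear-∘ : ∀ {k} {E′ : F n → F k} → IsLinear E′ → IsLinear (E′ ∘ E)
  linear-∘ {E′ = E′} E′-linear = isLinear λ x y →
    ≡-trans (cong E′ (⊕-homo x y)) (IsLinear.⊕-homo E′-linear (E x) (E y))

  linear-lookup : ∀ p → IsLinearForm (λ x → lookup (E x) p)
  linear-lookup p = isLinearForm λ x y →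
    ≡-trans (cong (λ z → lookup z p) (⊕-homo x y)) (lookup-zipWith _xor_ p (E x) (E y))

linearForm-0F : ∀ {m} {f : F m → Bool} → IsLinearForm f → f 0F ≡ false
linearForm-0F {f = f} f-linear = begin
  f 0F            ≡⟨ cong f (⊕-self 0F) ⟨
  f (0F ⊕ 0F)     ≡⟨ IsLinearForm.⊕-homo f-linear 0F 0F ⟩
  f 0F xor f 0F   ≡⟨ xor-same (f 0F) ⟩
  false           ∎

lookup-0F : ∀ {m} (p : Fin m) → lookup (0F {m}) p ≡ false
lookup-0F p = lookup-replicate p false

≡0F⊎pivot : ∀ {m} (u : F m) → u ≡ 0F ⊎ ∃ λ p → lookup u p ≡ true
≡0F⊎pivot []          = inj₁ refl
≡0F⊎pivot (true ∷ u)  = inj₂ (Fin.zero , refl)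
≡0F⊎pivot (false ∷ u) with ≡0F⊎pivot u
... | inj₁ u≡0F     = inj₁ (cong (false ∷_) u≡0F)
... | inj₂ (p , up) = inj₂ (Fin.suc p , up)

transvection : ∀ {m} → (F m → Bool) → F m → F m → F m
transvection f v x = x ⊕ f x · v

module _ {m} {f : F m → Bool} (f-linear : IsLinearForm f) (v : F m) where
  open IsLinearForm f-linear

  transvection-linear : IsLinear (transvection f v)
  transvection-linear = isLinear λ x y → begin
    (x ⊕ y) ⊕ f (x ⊕ y) · v         ≡⟨ cong (λ α → (x ⊕ y) ⊕ α · v) (⊕-homo x y) ⟩
    (x ⊕ y) ⊕ (f x xor f y) · v     ≡⟨ cong ((x ⊕ y) ⊕_) (·-distribʳ-xor (f x) (f y) v) ⟩
    (x ⊕ y) ⊕ (f x · v ⊕ f y · v)   ≡⟨ ⊕-interchange x y (f x · v) (f y · v) ⟩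
    (x ⊕ f x · v) ⊕ (y ⊕ f y · v)   ∎

  transvection-involutive : f v ≡ false → ∀ x → transvection f v (transvection f v x) ≡ x
  transvection-involutive fv≡false x = begin
    τx ⊕ f τx · v        ≡⟨ cong (λ α → τx ⊕ α · v) f-τx ⟩
    τx ⊕ f x · v         ≡⟨ ⊕-cancelʳ (f x · v) x ⟩
    x                    ∎
    where
    τx = transvection f v x
    f-· : ∀ α → f (α · v) ≡ false
    f-· true  = fv≡false
    f-· false = linearForm-0F f-linear
    f-τx : f τx ≡ f x
    f-τx = ≡-trans (⊕-homo x (f x · v)) (≡-trans (cong (f x xor_) (f-· (f x))) (xor-identityʳ (f x)))

Span₂ : ∀ {m} → F m → F m → F m → Set
Span₂ a b x = ∃₂ λ α β → x ≡ α · a ⊕ β · b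

annihilator₁ : ∀ {m} (u : F m) →
  ∃ λ E → IsLinear E × E u ≡ 0F × (∀ x → E x ≡ 0F → ∃ λ α → x ≡ α · u)
annihilator₁ u with ≡0F⊎pivot u
... | inj₁ u≡0F = id , id-linear , u≡0F , λ x x≡0F → false , x≡0F
... | inj₂ (p , up) = E , transvection-linear (linear-lookup id-linear p) u , Eu≡0F , kernel
  where
  E = transvection (λ x → lookup x p) u
  Eu≡0F : E u ≡ 0F
  Eu≡0F = ≡-trans (cong (λ α → u ⊕ α · u) up) (⊕-self u)
  kernel : ∀ x → E x ≡ 0F → ∃ λ α → x ≡ α · u
  kernel x Ex≡0F = lookup x p , ⊕≡0F⇒≡ x (lookup x p · u) Ex≡0F

annihilator₂ : ∀ {m} (a b : F m) →
  ∃ λ E → IsLinear E × E a ≡ 0F × E b ≡ 0F × (∀ x → E x ≡ 0F → Span₂ a b x)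
annihilator₂ a b with annihilator₁ a
... | E₁ , E₁-linear , E₁a≡0F , ker₁ with annihilator₁ (E₁ b)
... | E₂ , E₂-linear , E₂E₁b≡0F , ker₂ =
  E₂ ∘ E₁ , linear-∘ E₁-linear E₂-linear , ≡-trans (cong E₂ E₁a≡0F) (linear-0F E₂-linear) , E₂E₁b≡0F , kernel
  where
  kernel : ∀ x → E₂ (E₁ x) ≡ 0F → Span₂ a b x
  kernel x E₂E₁x≡0F with ker₂ (E₁ x) E₂E₁x≡0F
  ... | β , E₁x≡βE₁b with ker₁ (x ⊕ β · b) E₁[x⊕βb]≡0F
    where
    E₁[x⊕βb]≡0F : E₁ (x ⊕ β · b) ≡ 0F
    E₁[x⊕βb]≡0F = begin
      E₁ (x ⊕ β · b)        ≡⟨ IsLinear.⊕-homo E₁-linear x (β · b) ⟩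
      E₁ x ⊕ E₁ (β · b)     ≡⟨ cong (E₁ x ⊕_) (linear-· E₁-linear β b) ⟩
      E₁ x ⊕ β · E₁ b       ≡⟨ cong (_⊕ β · E₁ b) E₁x≡βE₁b ⟩
      β · E₁ b ⊕ β · E₁ b   ≡⟨ ⊕-self (β · E₁ b) ⟩
      0F                    ∎
  ... | α , x⊕βb≡αa = α , β , ≡-trans (sym (⊕-cancelʳ (β · b) x)) (cong (_⊕ β · b) x⊕βb≡αa)

separating-form : ∀ {m} (a b w : F m) → ¬ Span₂ a b w →
  ∃ λ f → IsLinearForm f × f a ≡ false × f b ≡ false × f w ≡ true
separating-form a b w w∉span with annihilator₂ a b
... | E , E-linear , Ea≡0F , Eb≡0F , kernel with ≡0F⊎pivot (E w)
...   | inj₁ Ew≡0F    = ⊥-elim (w∉span (kernel w Ew≡0F))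
...   | inj₂ (q , Ewq) =
  (λ x → lookup (E x) q) , linear-lookup E-linear q ,
  vanish Ea≡0F , vanish Eb≡0F , Ewq
  where
  vanish : ∀ {x} → E x ≡ 0F → lookup (E x) q ≡ false
  vanish Ex≡0F = ≡-trans (cong (λ z → lookup z q) Ex≡0F) (lookup-0F q)

j∉Span₂-i-j⊕l : ∀ {m} {i j l : F m} → j ≢ 0F → l ≢ 0F → i ≢ j → i ≢ l → ¬ Span₂ i (j ⊕ l) j
j∉Span₂-i-j⊕l {i = i} {j} {l} j≢0F l≢0F i≢j i≢l (α , β , j≡αi⊕β[j⊕l]) with α | β | j≡αi⊕β[j⊕l]
... | false | false | e = j≢0F (≡-trans e (⊕-identityˡ 0F))
... | true  | false | e = i≢j (sym (≡-trans e (⊕-identityʳ i)))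
... | false | true  | e = l≢0F (x≡x⊕y⇒y≡0F (≡-trans e (⊕-identityˡ (j ⊕ l))))
... | true  | true  | e = i≢l (⊕≡0F⇒≡ i l (x≡x⊕y⇒y≡0F (≡-trans e (⊕-leftComm i j l))))

swapping-involution : ∀ {m} {i j l : F m} → j ≢ 0F → l ≢ 0F → i ≢ j → i ≢ l →
  ∃ λ σ → IsLinear σ × (∀ x → σ (σ x) ≡ x) × σ i ≡ i × σ j ≡ l
swapping-involution {i = i} {j} {l} j≢0F l≢0F i≢j i≢l
  with separating-form i (j ⊕ l) j (j∉Span₂-i-j⊕l j≢0F l≢0F i≢j i≢l)
... | f , f-linear , fi , f[j⊕l] , fj =
  transvection f (j ⊕ l) ,
  transvection-linear f-linear (j ⊕ l) ,
  transvection-involutive f-linear (j ⊕ l) f[j⊕l] ,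
  ≡-trans (cong (λ α → i ⊕ α · (j ⊕ l)) fi) (⊕-identityʳ i) ,
  ≡-trans (cong (λ α → j ⊕ α · (j ⊕ l)) fj) (⊕-cancelˡ j l)

count : ∀ {a p} {A : Set a} {P : Pred A p} → Decidable P → List A → ℕ
count P? xs = length (filter P? xs)

module _ {a} {A : Set a} where

  count-++ : ∀ {p} {P : Pred A p} (P? : Decidable P) xs ys → count P? (xs ++ ys) ≡ count P? xs + count P? ys
  count-++ P? xs ys = ≡-trans (cong length (filter-++ P? xs ys)) (length-++ (filter P? xs))

  count-filter : ∀ {p q} {P : Pred A p} {Q : Pred A q} (P? : Decidable P) (Q? : Decidable Q) xs →
    count P? (filter Q? xs) ≡ count (Q? ∩? P?) xs
  count-filter P? Q? [] = refl
  count-filter P? Q? (x ∷ xs) with does (Q? x)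
  ... | false = count-filter P? Q? xs
  ... | true with does (P? x)
  ...   | true  = cong suc (count-filter P? Q? xs)
  ...   | false = count-filter P? Q? xs

  count-≐ : ∀ {p q} {P : Pred A p} {Q : Pred A q} (P? : Decidable P) (Q? : Decidable Q) →
    P ≐ Q → ∀ xs → count P? xs ≡ count Q? xs
  count-≐ P? Q? P≐Q xs = cong length (filter-≐ P? Q? P≐Q xs)

  count-map : ∀ {b p} {B : Set b} {P : Pred B p} (P? : Decidable P) (f : A → B) xs →
    count P? (map f xs) ≡ count (P? ∘ f) xs
  count-map P? f [] = refl
  count-map P? f (x ∷ xs) with does (P? (f x))
  ... | true  = cong suc (count-map P? f xs)
  ... | false = count-map P? f xs

sublists-map : ∀ {a b} {A : Set a} {B : Set b} (f : A → B) xs →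
  sublists (map f xs) ≡ map (map f) (sublists xs)
sublists-map f [] = refl
sublists-map f (x ∷ xs) = begin
  map (f x ∷_) (sublists (map f xs)) ++ sublists (map f xs)
    ≡⟨ cong (λ S → map (f x ∷_) S ++ S) (sublists-map f xs) ⟩
  map (f x ∷_) (map (map f) (sublists xs)) ++ map (map f) (sublists xs)
    ≡⟨ cong (_++ map (map f) (sublists xs)) (map-∘ (sublists xs)) ⟨
  map (map f ∘ (x ∷_)) (sublists xs) ++ map (map f) (sublists xs)
    ≡⟨ cong (_++ map (map f) (sublists xs)) (map-∘ (sublists xs)) ⟩
  map (map f) (map (x ∷_) (sublists xs)) ++ map (map f) (sublists xs)
    ≡⟨ map-++ (map f) (map (x ∷_) (sublists xs)) (sublists xs) ⟨
  map (map f) (map (x ∷_) (sublists xs) ++ sublists xs)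
    ∎

count-sublists-∷ : ∀ {a p} {A : Set a} {P : Pred (List A) p} (P? : Decidable P) x xs →
  count P? (sublists (x ∷ xs)) ≡ count (P? ∘ (x ∷_)) (sublists xs) + count P? (sublists xs)
count-sublists-∷ P? x xs = begin
  count P? (map (x ∷_) (sublists xs) ++ sublists xs)
    ≡⟨ count-++ P? (map (x ∷_) (sublists xs)) (sublists xs) ⟩
  count P? (map (x ∷_) (sublists xs)) + count P? (sublists xs)
    ≡⟨ cong (_+ count P? (sublists xs)) (count-map P? (x ∷_) (sublists xs)) ⟩
  count (P? ∘ (x ∷_)) (sublists xs) + count P? (sublists xs)
    ∎

count-sublists-↭ : ∀ {a p} {A : Set a} {P : Pred (List A) p} (P? : Decidable P) → P Respects _↭_ →
  ∀ {xs ys} → xs ↭ ys → count P? (sublists xs) ≡ count P? (sublists ys)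
count-sublists-↭ P? resp refl = refl
count-sublists-↭ P? resp (trans xs↭ys ys↭zs) =
  ≡-trans (count-sublists-↭ P? resp xs↭ys) (count-sublists-↭ P? resp ys↭zs)
count-sublists-↭ P? resp {x ∷ xs} {x ∷ ys} (prep x xs↭ys) = begin
  count P? (sublists (x ∷ xs))                               ≡⟨ count-sublists-∷ P? x xs ⟩
  count Px (sublists xs) + count P? (sublists xs)            ≡⟨ cong₂ _+_
                                                                  (count-sublists-↭ Px (resp ∘ prep x) xs↭ys)
                                                                  (count-sublists-↭ P? resp xs↭ys) ⟩
  count Px (sublists ys) + count P? (sublists ys)            ≡⟨ count-sublists-∷ P? x ys ⟨
  count P? (sublists (x ∷ ys))                               ∎
  where Px = P? ∘ (x ∷_)
count-sublists-↭ P? resp {x ∷ y ∷ xs} {y ∷ x ∷ ys} (swap x y xs↭ys) = begin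
  count P? (sublists (x ∷ y ∷ xs))
    ≡⟨ expand x y xs ⟩
  (count Pxy (sublists xs) + count Px (sublists xs)) + (count Py (sublists xs) + count P? (sublists xs))
    ≡⟨ +-interchange (count Pxy (sublists xs)) _ _ _ ⟩
  (count Pxy (sublists xs) + count Py (sublists xs)) + (count Px (sublists xs) + count P? (sublists xs))
    ≡⟨ cong₂ _+_ (cong₂ _+_ Pxy≡Pyx (count-sublists-↭ Py (resp ∘ prep y) xs↭ys))
                 (cong₂ _+_ (count-sublists-↭ Px (resp ∘ prep x) xs↭ys) (count-sublists-↭ P? resp xs↭ys)) ⟩
  (count Pyx (sublists ys) + count Py (sublists ys)) + (count Px (sublists ys) + count P? (sublists ys))
    ≡⟨ expand y x ys ⟨
  count P? (sublists (y ∷ x ∷ ys))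
    ∎
  where
  Px  = P? ∘ (x ∷_)
  Py  = P? ∘ (y ∷_)
  Pxy = P? ∘ (x ∷_) ∘ (y ∷_)
  Pyx = P? ∘ (y ∷_) ∘ (x ∷_)
  expand : ∀ u v zs → count P? (sublists (u ∷ v ∷ zs)) ≡
    (count (P? ∘ (u ∷_) ∘ (v ∷_)) (sublists zs) + count (P? ∘ (u ∷_)) (sublists zs)) +
    (count (P? ∘ (v ∷_)) (sublists zs) + count P? (sublists zs))
  expand u v zs = ≡-trans (count-sublists-∷ P? u (v ∷ zs))
    (cong₂ _+_ (count-sublists-∷ (P? ∘ (u ∷_)) v zs) (count-sublists-∷ P? v zs))
  Pxy≡Pyx : count Pxy (sublists xs) ≡ count Pyx (sublists ys)
  Pxy≡Pyx = ≡-trans (count-≐ Pxy Pyx (resp (swap x y refl) , resp (swap y x refl)) (sublists xs))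
                    (count-sublists-↭ Pyx (resp ∘ prep y ∘ prep x) xs↭ys)

module _ {a} {A : Set a} {σ : A → A} (σ-involutive : ∀ x → σ (σ x) ≡ x) where

  ↭-map-involution : ∀ {xs} → Unique xs → (∀ {x} → x ∈ xs → σ x ∈ xs) → xs ↭ map σ xs
  ↭-map-involution {xs} xs-unique σ-closed =
    ∼bag⇒↭ (unique∧set⇒bag xs-unique (Unique.map⁺ σ-injective xs-unique) (mk⇔ into outof))
    where
    σ-injective : ∀ {x y} → σ x ≡ σ y → x ≡ y
    σ-injective {x} {y} σx≡σy = ≡-trans (sym (σ-involutive x)) (≡-trans (cong σ σx≡σy) (σ-involutive y))
    into : ∀ {x} → x ∈ xs → x ∈ map σ xs
    into {x} x∈xs = subst (_∈ map σ xs) (σ-involutive x) (∈-map⁺ σ (σ-closed x∈xs))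
    outof : ∀ {x} → x ∈ map σ xs → x ∈ xs
    outof x∈σxs with ∈-map⁻ σ x∈σxs
    ... | y , y∈xs , refl = σ-closed y∈xs

  map-involution : ∀ xs → map σ (map σ xs) ≡ xs
  map-involution xs = ≡-trans (sym (map-∘ xs)) (≡-trans (map-cong σ-involutive xs) (map-id xs))

  count-sublists-involution : ∀ {p} {P : Pred (List A) p} (P? : Decidable P) → P Respects _↭_ →
    ∀ {xs} → Unique xs → (∀ {x} → x ∈ xs → σ x ∈ xs) →
    count P? (sublists xs) ≡ count (P? ∘ map σ) (sublists xs)
  count-sublists-involution P? resp {xs} xs-unique σ-closed = begin
    count P? (sublists xs)               ≡⟨ count-sublists-↭ P? resp (↭-map-involution xs-unique σ-closed) ⟩
    count P? (sublists (map σ xs))       ≡⟨ cong (count P?) (sublists-map σ xs) ⟩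
    count P? (map (map σ) (sublists xs)) ≡⟨ count-map P? (map σ) (sublists xs) ⟩
    count (P? ∘ map σ) (sublists xs)     ∎

allF-unique : ∀ m → Unique (allF m)
allF-unique zero    = All.[] ∷ []
allF-unique (suc m) =
  Unique.++⁺ (Unique.map⁺ ∷-injectiveʳ (allF-unique m)) (Unique.map⁺ ∷-injectiveʳ (allF-unique m)) disjoint
  where
  disjoint : ∀ {v} → ¬ (v ∈ map (false ∷_) (allF m) × v ∈ map (true ∷_) (allF m))
  disjoint (v∈false∷ , v∈true∷) with ∈-map⁻ (false ∷_) v∈false∷ | ∈-map⁻ (true ∷_) v∈true∷
  ... | _ , _ , refl | _ , _ , ()

∈-allF : ∀ {m} (x : F m) → x ∈ allF m
∈-allF []                   = here refl
∈-allF {suc m} (false ∷ x) = ∈-++⁺ˡ (∈-map⁺ (false ∷_) (∈-allF x))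
∈-allF {suc m} (true ∷ x)  = ∈-++⁺ʳ (map (false ∷_) (allF m)) (∈-map⁺ (true ∷_) (∈-allF x))

nonzeroF-unique : ∀ m → Unique (nonzeroF m)
nonzeroF-unique m = Unique.filter⁺ (λ x → ¬? (x ≟F 0F)) (allF-unique m)

∈-nonzeroF⁺ : ∀ {m} {x : F m} → x ≢ 0F → x ∈ nonzeroF m
∈-nonzeroF⁺ {x = x} x≢0F = ∈-filter⁺ (λ x → ¬? (x ≟F 0F)) (∈-allF x) x≢0F

∈-nonzeroF⁻ : ∀ {m} {x : F m} → x ∈ nonzeroF m → x ≢ 0F
∈-nonzeroF⁻ {m} x∈ = proj₂ (∈-filter⁻ (λ x → ¬? (x ≟F 0F)) {xs = allF m} x∈)

nonzeroF-closed : ∀ {m} {σ : F m → F m} → IsLinear σ → (∀ x → σ (σ x) ≡ x) →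
  ∀ {x} → x ∈ nonzeroF m → σ x ∈ nonzeroF m
nonzeroF-closed {σ = σ} σ-linear σ-involutive {x} x∈ = ∈-nonzeroF⁺ λ σx≡0F →
  ∈-nonzeroF⁻ x∈ (≡-trans (sym (σ-involutive x)) (≡-trans (cong σ σx≡0F) (linear-0F σ-linear)))

InWij : ∀ {m} → ℕ → F m → F m → Pred (List (F m)) 0ℓ
InWij k i j B = (length B ≡ k × sumF B ≡ 0F) × (i ∈ B × j ∈ B)

inWij? : ∀ {m} k (i j : F m) → Decidable (InWij k i j)
inWij? k i j = (λ B → (length B ℕ-≟ k) ×-dec (sumF B ≟F 0F)) ∩? (λ B → (i ∈F? B) ×-dec (j ∈F? B))

cardWij≡count : ∀ m k (i j : F m) → cardWij m k i j ≡ count (inWij? k i j) (sublists (nonzeroF m))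
cardWij≡count m k i j = count-filter _ _ (sublists (nonzeroF m))

InWij-resp-↭ : ∀ {m} k (i j : F m) → InWij k i j Respects _↭_
InWij-resp-↭ k i j B↭B′ ((∣B∣≡k , ΣB≡0F) , i∈B , j∈B) =
  (≡-trans (sym (↭-length B↭B′)) ∣B∣≡k , ≡-trans (sym (sumF-↭ B↭B′)) ΣB≡0F) ,
  ∈-resp-↭ B↭B′ i∈B , ∈-resp-↭ B↭B′ j∈B

InWij-map : ∀ {m k} {σ : F m → F m} {i j i′ j′ B} → IsLinear σ → σ i ≡ i′ → σ j ≡ j′ →
  InWij k i j B → InWij k i′ j′ (map σ B)
InWij-map {σ = σ} {B = B} σ-linear refl refl ((∣B∣≡k , ΣB≡0F) , i∈B , j∈B) =
  (≡-trans (length-map σ B) ∣B∣≡k ,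
   ≡-trans (linear-sumF σ-linear B) (≡-trans (cong σ ΣB≡0F) (linear-0F σ-linear))) ,
  ∈-map⁺ σ i∈B , ∈-map⁺ σ j∈B

InWij-swap : ∀ {m k} {σ : F m → F m} {i j l} → IsLinear σ → (∀ x → σ (σ x) ≡ x) → σ i ≡ i → σ j ≡ l →
  (InWij k i j ∘ map σ) ≐ InWij k i l
InWij-swap {k = k} {σ} {i} {j} {l} σ-linear σ-involutive σi≡i σj≡l =
  (λ {B} w → subst (InWij k i l) (map-involution σ-involutive B) (InWij-map σ-linear σi≡i σj≡l w)) ,
  InWij-map σ-linear σi≡i σl≡j
  where
  σl≡j : σ l ≡ j
  σl≡j = ≡-trans (cong σ (sym σj≡l)) (σ-involutive j)

lemma2p6 : (m : ℕ) → 3 ≤ m → (k : ℕ) → 3 ≤ k → k ≤ 2 ^ m ∸ 4 →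
    (i j l : F m) → i ≢ 0F → j ≢ 0F → l ≢ 0F →
    i ≢ j → i ≢ l → j ≢ l →
    cardWij m k i j ≡ cardWij m k i l
lemma2p6 m _ k _ _ i j l _ j≢0F l≢0F i≢j i≢l _ with swapping-involution j≢0F l≢0F i≢j i≢l
... | σ , σ-linear , σ-involutive , σi≡i , σj≡l = begin
  cardWij m k i j                  ≡⟨ cardWij≡count m k i j ⟩
  count (inWij? k i j) S           ≡⟨ count-sublists-involution σ-involutive (inWij? k i j) (InWij-resp-↭ k i j)
                                        (nonzeroF-unique m) (nonzeroF-closed σ-linear σ-involutive) ⟩
  count (inWij? k i j ∘ map σ) S   ≡⟨ count-≐ _ (inWij? k i l) (InWij-swap σ-linear σ-involutive σi≡i σj≡l) S ⟩
  count (inWij? k i l) S           ≡⟨ cardWij≡count m k i l ⟨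
  cardWij m k i l                  ∎
  where S = sublists (nonzeroF m)
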